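{- Let $t\in\mathbb N$, let $D$ be an oriented graph with $\delta^0(D)\ge t$, and let $w\in V(D)$. Then $D$ contains a connected antimatching $M=\{a_ib_i\}_{1\le i\le t}$ with $a_1=w$ such that $\mathrm{ood}(a_1,a_i)\le 8t$ for every $1\le i\le t$.
   Context: An oriented graph is a digraph with no loops and at most one edge between any pair of vertices; $uv$ denotes an edge directed from $u$ to $v$. $\delta^0(D)$ is the minimum over all vertices of their in- and out-degrees. An antiwalk is a sequence of vertices $v_0v_1\dots v_\ell$ ($\ell\ge0$; vertices and edges may repeat) such that each consecutive pair forms an edge of $D$ and the directions of consecutive edges alternate; its length is $\ell$. An out-out-walk from $a$ to $z$ is either the trivial walk $a$ (when $z=a$), or a nontrivial antiwalk $a=v_0,\dots,v_\ell=z$ whose first edge is $v_0v_1$ and whose last edge is $v_\ell v_{\ell-1}$. $\mathrm{Out}(D,a)$ is the set of vertices $z$ reachable from $a$ by an out-out-walk. The out-out-distance $\mathrm{ood}(a,a')$ is the length of a shortest out-out-walk from $a$ to $a'$ (or $\infty$ if none exists). A connected antimatching of size $m$ in $D$ is a set $M=\{a_ib_i\}_{1\le i\le m}$ of edges of $D$ (each directed from $a_i$ to $b_i$) forming a matching in the underlying graph, such that $a_i\in\mathrm{Out}(D,a_1)$ for every $1\le i\le m$. -}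

module Defs where

open import Data.Nat using (ℕ; zero; suc; _≤_)
open import Data.Fin using (Fin; toℕ)
open import Data.Bool using (Bool; true; false; T)
open import Data.List using (length; filterᵇ)
open import Data.List using () renaming (allFin to allFinL)
open import Data.Product using (Σ; _×_; ∃; ∃-syntax)
open import Data.Sum using (_⊎_)
open import Relation.Binary.PropositionalEquality using (_≡_; _≢_)

-- A finite oriented graph on vertex set Fin n; E u v = true means uv is an edge (u → v).
record OrientedGraph (n : ℕ) : Set where
  field
    E        : Fin n → Fin n → Bool
    loopless : ∀ v → E v v ≡ false
    oriented : ∀ u v → E u v ≡ true → E v u ≡ false

module _ {n : ℕ} (D : OrientedGraph n) where
  open OrientedGraph D

  Edge : Fin n → Fin n → Set
  Edge u v = T (E u v)

  outdeg : Fin n → ℕ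
  outdeg v = length (filterᵇ (λ u → E v u) (allFinL n))

  indeg : Fin n → ℕ
  indeg v = length (filterᵇ (λ u → E u v) (allFinL n))

  MinSemiDegreeAtLeast : ℕ → Set
  MinSemiDegreeAtLeast t = ∀ v → (t ≤ outdeg v) × (t ≤ indeg v)

  -- Nontrivial antiwalks (alternating directions) whose LAST edge is backward,
  -- i.e. of the form ... v_ℓ v_{ℓ-1}.
  data FwdW : Fin n → Fin n → ℕ → Set
  data BwdW : Fin n → Fin n → ℕ → Set
  data FwdW where
    fwd : ∀ {u v z ℓ} → Edge u v → BwdW v z ℓ → FwdW u z (suc ℓ)
  data BwdW where
    bwd-end : ∀ {u z} → Edge z u → BwdW u z 1
    bwd     : ∀ {u v z ℓ} → Edge v u → FwdW v z ℓ → BwdW u z (suc ℓ)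

  -- out-out-walk from a to z of length ℓ: trivial walk, or nontrivial antiwalk
  -- with first edge a v₁ and last edge z v_{ℓ-1}.
  OOWalk : Fin n → Fin n → ℕ → Set
  OOWalk a z ℓ = ((a ≡ z) × (ℓ ≡ 0)) ⊎ FwdW a z ℓ

  Out : Fin n → Fin n → Set
  Out a z = ∃[ ℓ ] OOWalk a z ℓ

  -- ood(a, z) ≤ k  (a shortest out-out-walk has length ≤ k, i.e. some one does)
  OodAtMost : Fin n → Fin n → ℕ → Set
  OodAtMost a z k = ∃[ ℓ ] (ℓ ≤ k × OOWalk a z ℓ)

  IsMatching : (m : ℕ) → (Fin m → Fin n) → (Fin m → Fin n) → Set
  IsMatching m a b =
    (∀ i → Edge (a i) (b i)) ×
    (∀ i j → i ≢ j → (a i ≢ a j) × (a i ≢ b j) × (b i ≢ b j))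

  -- connected antimatching of size m; index 0 of Fin m plays the role of a₁.
  IsConnectedAntimatching : (m : ℕ) → (Fin m → Fin n) → (Fin m → Fin n) → Set
  IsConnectedAntimatching m a b =
    IsMatching m a b × (∀ i j → toℕ j ≡ 0 → Out (a j) (a i))

-- Greedy augmentation, using only edges whose tail lies within out-out-distance
-- 4 ≤ 8t of w.  Fix an out-neighbour y₀ of w.  There are 2t distinct candidate
-- vertices, each the hub of a fan of t such edges with pairwise distinct leaves:
-- the in-neighbours of y₀ together with the out-neighbours of w if these are
-- disjoint, and otherwise the in- and out-neighbours of a vertex x with
-- w → x → y₀.  A matching of k < t edges leaves two candidates u ≠ v free
-- (pigeonhole on 2k + 1 labels).  Their 2t leaves cannot all be blocked by the
-- 2k matched vertices: either a leaf is free and its spoke is added, or a leaf of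
-- u and a leaf of v are the two ends of one matching edge, which is exchanged for
-- the two spokes.  Finally w is made the tail of the first edge, by one more such
-- augmentation when w is a head.
module Submission where

open import Defs
open import Data.Nat using (ℕ; zero; suc; _≤_; _<_; _*_; _+_; z≤n; s≤s)
import Data.Nat.Properties as ℕ
open import Data.Fin using (Fin; toℕ; zero; suc; inject≤; punchIn; combine; splitAt; join)
open import Data.Fin.Properties
  using (_≟_; any?; pigeonhole; <⇒≢; combine-injective; suc-injective; inject≤-injective;
         punchIn-injective; punchInᵢ≢i; join-splitAt)
open import Data.Bool using (Bool; true; false; T; not; _xor_; if_then_else_)
open import Data.Bool.Properties using (T?; T-≡; not-injective; not-¬)
open import Data.List using (List; length; filterᵇ; lookup)
open import Data.List using () renaming (allFin to allFinL)
open import Data.List.Relation.Unary.Unique.Propositional using (Unique)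
import Data.List.Relation.Unary.AllPairs as AllPairs
import Data.List.Relation.Unary.Unique.Propositional.Properties as Unique
import Data.List.Relation.Unary.All as All
open import Data.List.Membership.Propositional.Properties using (∈-filter⁻; ∈-lookup)
open import Data.Vec.Functional using (_∷_; removeAt)
open import Data.Product using (Σ; _×_; _,_; proj₁; proj₂; ∃; ∃-syntax; ∃₂; map₁)
open import Data.Product.Properties using (,-injectiveˡ; ,-injectiveʳ)
open import Data.Sum using (_⊎_; inj₁; inj₂; [_,_]′)
open import Data.Empty using (⊥-elim)
open import Function using (_∘_; const)
open import Function.Bundles using (Equivalence)
open import Function.Definitions using (Injective)
open import Relation.Nullary using (¬_; Dec; yes; no)
open import Relation.Binary.PropositionalEquality

Unique⇒lookup-injective : ∀ {A : Set} {xs : List A} → Unique xs → Injective _≡_ _≡_ (lookup xs)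
Unique⇒lookup-injective (_  AllPairs.∷ _) {zero}  {zero}  _ = refl
Unique⇒lookup-injective (x∉ AllPairs.∷ _) {zero}  {suc j} e = ⊥-elim (All.lookup x∉ (∈-lookup j) e)
Unique⇒lookup-injective (x∉ AllPairs.∷ _) {suc i} {zero}  e = ⊥-elim (All.lookup x∉ (∈-lookup i) (sym e))
Unique⇒lookup-injective (_  AllPairs.∷ u) {suc i} {suc j} e = cong suc (Unique⇒lookup-injective u e)

filterᵇ-enumeration : ∀ {n t} (p : Fin n → Bool) → t ≤ length (filterᵇ p (allFinL n)) →
  Σ (Fin t → Fin n) λ f → Injective _≡_ _≡_ f × (∀ i → T (p (f i)))
filterᵇ-enumeration {n} {t} p t≤ = f , f-injective , f-satisfies
  where
  ps = filterᵇ p (allFinL n)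
  f : Fin t → Fin n
  f i = lookup ps (inject≤ i t≤)
  f-injective : Injective _≡_ _≡_ f
  f-injective e = inject≤-injective t≤ t≤ _ _
    (Unique⇒lookup-injective (Unique.filter⁺ (T? ∘ p) (Unique.allFin⁺ n)) e)
  f-satisfies : ∀ i → T (p (f i))
  f-satisfies i = proj₂ (∈-filter⁻ (T? ∘ p) {xs = allFinL n} (∈-lookup (inject≤ i t≤)))

[,]-injective : ∀ {A B C : Set} {f : A → C} {g : B → C} →
  Injective _≡_ _≡_ f → Injective _≡_ _≡_ g → (∀ a b → f a ≢ g b) →
  Injective _≡_ _≡_ [ f , g ]′
[,]-injective f-inj g-inj f≢g {inj₁ a} {inj₁ a′} e = cong inj₁ (f-inj e)
[,]-injective f-inj g-inj f≢g {inj₁ a} {inj₂ b}  e = ⊥-elim (f≢g a b e)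
[,]-injective f-inj g-inj f≢g {inj₂ b} {inj₁ a}  e = ⊥-elim (f≢g a b (sym e))
[,]-injective f-inj g-inj f≢g {inj₂ b} {inj₂ b′} e = cong inj₂ (g-inj e)

pigeonhole-⊎ : ∀ {m s t} → m < s + t → (f : Fin s ⊎ Fin t → Fin m) →
  ∃₂ λ p q → p ≢ q × f p ≡ f q
pigeonhole-⊎ {s = s} {t} m<s+t f with pigeonhole m<s+t (f ∘ splitAt s)
... | i , j , i<j , e = splitAt s i , splitAt s j , splitAt-distinct , e
  where
  splitAt-distinct : splitAt s i ≢ splitAt s j
  splitAt-distinct e′ = <⇒≢ i<j
    (trans (sym (join-splitAt s t i)) (trans (cong (join s t) e′) (join-splitAt s t j)))

suc[k*2]<t+t : ∀ {k t} → k < t → suc (k * 2) < t + t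
suc[k*2]<t+t {k} k<t rewrite ℕ.*-comm k 2 | ℕ.+-identityʳ k = ℕ.+-mono-≤-< k<t k<t

bit : Bool → Fin 2
bit false = zero
bit true  = suc zero

bit-injective : Injective _≡_ _≡_ bit
bit-injective {false} {false} _ = refl
bit-injective {true}  {true}  _ = refl

module GraphProperties {n : ℕ} (D : OrientedGraph n) where
  open OrientedGraph D

  edge-irreflexive : ∀ {u v} → Edge D u v → u ≢ v
  edge-irreflexive {u} uu refl = subst T (loopless u) uu

  edge-asymmetric : ∀ {u v} → Edge D u v → ¬ Edge D v u
  edge-asymmetric {u} {v} uv = subst T (oriented u v (Equivalence.to T-≡ uv))

  fwdW-extend : ∀ {a x y z ℓ} → FwdW D a x ℓ → Edge D x y → Edge D z y → FwdW D a z (2 + ℓ)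
  bwdW-extend : ∀ {a x y z ℓ} → BwdW D a x ℓ → Edge D x y → Edge D z y → BwdW D a z (2 + ℓ)
  fwdW-extend (fwd e walk)  xy zy = fwd e (bwdW-extend walk xy zy)
  bwdW-extend (bwd-end e)   xy zy = bwd e (fwd xy (bwd-end zy))
  bwdW-extend (bwd e walk)  xy zy = bwd e (fwdW-extend walk xy zy)

  oodAtMost-refl : ∀ a → OodAtMost D a a 0
  oodAtMost-refl a = 0 , z≤n , inj₁ (refl , refl)

  oodAtMost-mono : ∀ {a z k k′} → k ≤ k′ → OodAtMost D a z k → OodAtMost D a z k′
  oodAtMost-mono k≤k′ (ℓ , ℓ≤k , walk) = ℓ , ℕ.≤-trans ℓ≤k k≤k′ , walk

  oodAtMost-extend : ∀ {a x y z k} → OodAtMost D a x k → Edge D x y → Edge D z y →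
    OodAtMost D a z (2 + k)
  oodAtMost-extend (_ , _ , inj₁ (refl , refl)) xy zy = 2 , s≤s (s≤s z≤n) , inj₂ (fwd xy (bwd-end zy))
  oodAtMost-extend (ℓ , ℓ≤k , inj₂ walk)        xy zy = 2 + ℓ , s≤s (s≤s ℓ≤k) , inj₂ (fwdW-extend walk xy zy)

  module Neighbours {t : ℕ} (δ : MinSemiDegreeAtLeast D t) where

    outNeighbours : ∀ v → Σ (Fin t → Fin n) λ f → Injective _≡_ _≡_ f × (∀ i → Edge D v (f i))
    outNeighbours v = filterᵇ-enumeration (E v) (proj₁ (δ v))

    inNeighbours : ∀ v → Σ (Fin t → Fin n) λ f → Injective _≡_ _≡_ f × (∀ i → Edge D (f i) v)
    inNeighbours v = filterᵇ-enumeration (λ u → E u v) (proj₂ (δ v))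

-- An edge is stored as the map Bool → vertex sending false to its tail and true
-- to its head.
module Matchings {n : ℕ} (D : OrientedGraph n) (P : Fin n → Set) where
  open GraphProperties D

  record Arc : Set where
    field
      end    : Bool → Fin n
      edge   : Edge D (end false) (end true)
      tail∈P : P (end false)
  open Arc public

  arcOf : ∀ {u v} → Edge D u v → P u → Arc
  arcOf {u} {v} uv u∈P = record { end = λ x → if x then v else u ; edge = uv ; tail∈P = u∈P }

  end-injective : ∀ a → Injective _≡_ _≡_ (end a)
  end-injective a {false} {false} _ = refl
  end-injective a {false} {true}  e = ⊥-elim (edge-irreflexive (edge a) e)
  end-injective a {true}  {false} e = ⊥-elim (edge-irreflexive (edge a) (sym e))
  end-injective a {true}  {true}  _ = refl

  Slot : ℕ → Set
  Slot k = Fin k × Bool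

  ends : ∀ {k} → (Fin k → Arc) → Slot k → Fin n
  ends arcs (i , x) = end (arcs i) x

  record Matching (k : ℕ) : Set where
    field
      arc            : Fin k → Arc
      ends-injective : Injective _≡_ _≡_ (ends arc)

    endpoint : Slot k → Fin n
    endpoint = ends arc
  open Matching public

  Covers : ∀ {k} → Matching k → Fin n → Set
  Covers m z = ∃ λ s → endpoint m s ≡ z

  covers? : ∀ {k} (m : Matching k) z → Dec (Covers m z)
  covers? m z with any? (λ i → endpoint m (i , false) ≟ z) | any? (λ i → endpoint m (i , true) ≟ z)
  ... | yes (i , e) | _          = yes ((i , false) , e)
  ... | no _        | yes (i , e) = yes ((i , true) , e)
  ... | no ¬tail    | no ¬head   = no λ { ((i , false) , e) → ¬tail (i , e)
                                        ; ((i , true)  , e) → ¬head (i , e) }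

  covered≢uncovered : ∀ {k} (m : Matching k) {z z′} → Covers m z → ¬ Covers m z′ → z ≢ z′
  covered≢uncovered m z∈ z′∉ refl = z′∉ z∈

  ∅ : Matching 0
  ∅ = record { arc = λ () ; ends-injective = λ { {() , _} } }

  add : ∀ {k} (a : Arc) (m : Matching k) → (∀ x → ¬ Covers m (end a x)) → Matching (suc k)
  add a m fresh = record { arc = a ∷ arc m ; ends-injective = injective }
    where
    injective : Injective _≡_ _≡_ (ends (a ∷ arc m))
    injective {zero , x}  {zero , y}  e = cong (zero ,_) (end-injective a e)
    injective {zero , x}  {suc j , y} e = ⊥-elim (fresh x ((j , y) , sym e))
    injective {suc i , x} {zero , y}  e = ⊥-elim (fresh y ((i , x) , e))
    injective {suc i , x} {suc j , y} e = cong (map₁ suc) (ends-injective m e)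

  ∉-add : ∀ {k z} a (m : Matching k) fresh →
    (∀ x → end a x ≢ z) → ¬ Covers m z → ¬ Covers (add a m fresh) z
  ∉-add a m fresh a≢z z∉ ((zero , x)  , e) = a≢z x e
  ∉-add a m fresh a≢z z∉ ((suc i , x) , e) = z∉ ((i , x) , e)

  remove : ∀ {k} → Matching (suc k) → Fin (suc k) → Matching k
  remove m j = record { arc = removeAt (arc m) j ; ends-injective = injective }
    where
    injective : Injective _≡_ _≡_ (ends (removeAt (arc m) j))
    injective e with ends-injective m e
    ... | same = cong₂ _,_ (punchIn-injective j _ _ (,-injectiveˡ same)) (,-injectiveʳ same)

  covers-remove⁻ : ∀ {k z} (m : Matching (suc k)) j → Covers (remove m j) z → Covers m z
  covers-remove⁻ m j ((i , x) , e) = (punchIn j i , x) , e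

  removed-uncovered : ∀ {k} (m : Matching (suc k)) j x → ¬ Covers (remove m j) (endpoint m (j , x))
  removed-uncovered m j x ((i , y) , e) = punchInᵢ≢i j i (,-injectiveˡ (ends-injective m e))

module Fans {n : ℕ} (D : OrientedGraph n) (P : Fin n → Set) (t : ℕ) where
  open Matchings D P

  record Fan (u : Fin n) : Set where
    field
      side           : Bool
      spoke          : Fin t → Arc
      spoke-hub      : ∀ i → end (spoke i) side ≡ u
      leaf-injective : Injective _≡_ _≡_ (λ i → end (spoke i) (not side))

    leaf : Fin t → Fin n
    leaf i = end (spoke i) (not side)

    spoke-ends : (Q : Fin n → Set) → Q u → ∀ i → Q (leaf i) → ∀ x → Q (end (spoke i) x)
    spoke-ends Q Qu i Qleaf x with side | spoke-hub i
    spoke-ends Q Qu i Qleaf false | false | hub = subst Q (sym hub) Qu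
    spoke-ends Q Qu i Qleaf true  | false | _   = Qleaf
    spoke-ends Q Qu i Qleaf false | true  | _   = Qleaf
    spoke-ends Q Qu i Qleaf true  | true  | hub = subst Q (sym hub) Qu
  open Fan public

  module _ (δ : MinSemiDegreeAtLeast D t) where
    open GraphProperties.Neighbours D δ

    outFan : ∀ {u} → P u → Fan u
    outFan {u} u∈P with outNeighbours u
    ... | f , f-inj , u→f = record
      { side = false ; spoke = λ i → arcOf (u→f i) u∈P
      ; spoke-hub = λ _ → refl ; leaf-injective = f-inj }

    inFan : ∀ {u} → (∀ {z} → Edge D z u → P z) → Fan u
    inFan {u} in⊆P with inNeighbours u
    ... | g , g-inj , g→u = record
      { side = true ; spoke = λ i → arcOf (g→u i) (in⊆P (g→u i))
      ; spoke-hub = λ _ → refl ; leaf-injective = g-inj }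

module Augmentation {n : ℕ} (D : OrientedGraph n) (P : Fin n → Set) {t : ℕ} where
  open Matchings D P
  open Fans D P t

  module _ {k : ℕ} (m : Matching k) where

    data Collision (z z′ : Fin n) (b b′ : Bool) : Set where
      both-free : ¬ Covers m z → ¬ Covers m z′ → Collision z z′ b b′
      same-arc  : ∀ j x x′ → endpoint m (j , x) ≡ z → endpoint m (j , x′) ≡ z′ →
                  b xor x ≡ b′ xor x′ → Collision z z′ b b′

    label : ∀ {z} → Dec (Covers m z) → Bool → Fin (suc (k * 2))
    label (no _)               b = zero
    label (yes ((j , x) , _)) b = suc (combine j (bit (b xor x)))

    label-collision : ∀ {z z′ b b′} (d : Dec (Covers m z)) (d′ : Dec (Covers m z′)) →
      label d b ≡ label d′ b′ → Collision z z′ b b′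
    label-collision (no z∉) (no z′∉) _ = both-free z∉ z′∉
    label-collision (yes ((j , x) , e)) (yes ((j′ , x′) , e′)) same
      with combine-injective j _ j′ _ (suc-injective same)
    ... | refl , bits = same-arc j x x′ e e′ (bit-injective bits)

    collision : k < t → (c : Fin t ⊎ Fin t → Fin n) (flag : Fin t ⊎ Fin t → Bool) →
      ∃₂ λ p q → p ≢ q × Collision (c p) (c q) (flag p) (flag q)
    collision k<t c flag with pigeonhole-⊎ (suc[k*2]<t+t k<t) (λ p → label (covers? m (c p)) (flag p))
    ... | p , q , p≢q , same = p , q , p≢q , label-collision _ _ same

    uncovered-pair : k < t → (c : Fin t ⊎ Fin t → Fin n) → Injective _≡_ _≡_ c →
      ∃₂ λ p q → p ≢ q × ¬ Covers m (c p) × ¬ Covers m (c q)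
    uncovered-pair k<t c c-injective with collision k<t c (const false)
    ... | p , q , p≢q , both-free p∉ q∉ = p , q , p≢q , p∉ , q∉
    ... | p , q , p≢q , same-arc j x x′ e e′ refl = ⊥-elim (p≢q (c-injective (trans (sym e) e′)))

  Augmented : ℕ → ∀ {u} → Fan u → Set
  Augmented k {u} fu = Σ (Matching (suc k)) λ m′ → ¬ Covers m′ u ⊎ ∃ λ j → endpoint m′ (j , side fu) ≡ u

  module _ {u v} (u≢v : u ≢ v) (fu : Fan u) (fv : Fan v) where

    exchange : ∀ {k} (m : Matching k) → ¬ Covers m u → ¬ Covers m v → ∀ j {x x′} → x ≢ x′ → ∀ i i′ →
      endpoint m (j , x) ≡ leaf fu i → endpoint m (j , x′) ≡ leaf fv i′ → Augmented k fu
    exchange {suc k} m u∉ v∉ j {x} {x′} x≢x′ i i′ e e′ =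
      add (spoke fv i′) m₁ v-fresh , inj₂ (suc zero , spoke-hub fu i)
      where
      m₀ = remove m j
      leaf-u∉ : ¬ Covers m₀ (leaf fu i)
      leaf-u∉ = subst (¬_ ∘ Covers m₀) e (removed-uncovered m j x)
      leaf-v∉ : ¬ Covers m₀ (leaf fv i′)
      leaf-v∉ = subst (¬_ ∘ Covers m₀) e′ (removed-uncovered m j x′)
      u-fresh : ∀ y → ¬ Covers m₀ (end (spoke fu i) y)
      u-fresh = spoke-ends fu (¬_ ∘ Covers m₀) (u∉ ∘ covers-remove⁻ m j) i leaf-u∉
      m₁ = add (spoke fu i) m₀ u-fresh
      avoids : ∀ {z} → ¬ Covers m₀ z → u ≢ z → leaf fu i ≢ z → ¬ Covers m₁ z
      avoids z∉ u≢z leaf≢z = ∉-add (spoke fu i) m₀ u-fresh (spoke-ends fu (_≢ _) u≢z i leaf≢z) z∉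
      v-fresh : ∀ y → ¬ Covers m₁ (end (spoke fv i′) y)
      v-fresh = spoke-ends fv (¬_ ∘ Covers m₁)
        (avoids (v∉ ∘ covers-remove⁻ m j) u≢v (covered≢uncovered m ((j , x) , e) v∉)) i′
        (avoids leaf-v∉ (covered≢uncovered m ((j , x′) , e′) u∉ ∘ sym)
                        (λ same → x≢x′ (,-injectiveʳ (ends-injective m (trans e (trans same (sym e′)))))))

    module _ {k} (m : Matching k) (u∉ : ¬ Covers m u) (v∉ : ¬ Covers m v) where

      add-spoke-u : ∀ i → ¬ Covers m (leaf fu i) → Augmented k fu
      add-spoke-u i leaf∉ =
        add (spoke fu i) m (spoke-ends fu (¬_ ∘ Covers m) u∉ i leaf∉) , inj₂ (zero , spoke-hub fu i)

      add-spoke-v : ∀ i → ¬ Covers m (leaf fv i) → leaf fv i ≢ u → Augmented k fu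
      add-spoke-v i leaf∉ leaf≢u =
        add (spoke fv i) m v-fresh , inj₁ (∉-add (spoke fv i) m v-fresh (spoke-ends fv (_≢ u) (u≢v ∘ sym) i leaf≢u) u∉)
        where
        v-fresh = spoke-ends fv (¬_ ∘ Covers m) v∉ i leaf∉

      same-fan-collision : ∀ {z} (f : Fan z) j {x x′} i i′ → x ≡ x′ → i ≢ i′ →
        endpoint m (j , x) ≡ leaf f i → endpoint m (j , x′) ≡ leaf f i′ → Augmented k fu
      same-fan-collision f j i i′ refl i≢i′ e e′ = ⊥-elim (i≢i′ (leaf-injective f (trans (sym e) e′)))

      -- Leaves of v are flagged, so a u-leaf and a v-leaf collide exactly when they
      -- are the opposite ends of one matching edge.
      augment : k < t → Augmented k fu
      augment k<t with collision m k<t [ leaf fu , leaf fv ]′ [ const false , const true ]′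
      ... | inj₁ i , _ , _ , both-free leaf∉ _ = add-spoke-u i leaf∉
      ... | inj₂ _ , inj₁ i′ , _ , both-free _ leaf∉ = add-spoke-u i′ leaf∉
      ... | inj₂ i , inj₂ i′ , p≢q , both-free leaf∉ leaf′∉ with leaf fv i ≟ u
      ...   | yes leaf≡u = add-spoke-v i′ leaf′∉
                             (λ leaf′≡u → p≢q (cong inj₂ (leaf-injective fv (trans leaf≡u (sym leaf′≡u)))))
      ...   | no  leaf≢u = add-spoke-v i leaf∉ leaf≢u
      augment k<t | inj₁ i , inj₁ i′ , p≢q , same-arc j x x′ e e′ flags =
        same-fan-collision fu j i i′ flags (p≢q ∘ cong inj₁) e e′
      augment k<t | inj₂ i , inj₂ i′ , p≢q , same-arc j x x′ e e′ flags =
        same-fan-collision fv j i i′ (not-injective flags) (p≢q ∘ cong inj₂) e e′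
      augment k<t | inj₁ i , inj₂ i′ , _ , same-arc j x x′ e e′ flags =
        exchange m u∉ v∉ j (λ x≡x′ → not-¬ x≡x′ flags) i i′ e e′
      augment k<t | inj₂ i , inj₁ i′ , _ , same-arc j x x′ e e′ flags =
        exchange m u∉ v∉ j (λ x′≡x → not-¬ x′≡x (sym flags)) i′ i e′ e

module Construction {n : ℕ} (D : OrientedGraph n) {t : ℕ} (δ : MinSemiDegreeAtLeast D t)
                    {w y₀ : Fin n} (w→y₀ : Edge D w y₀) where
  open OrientedGraph D using (E)
  open GraphProperties D
  open GraphProperties.Neighbours D δ

  Near : Fin n → Set
  Near z = OodAtMost D w z 4

  open Matchings D Near
  open Fans D Near t
  open Augmentation D Near {t}

  near₂ : ∀ {x z} → Edge D w x → Edge D z x → OodAtMost D w z 2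
  near₂ = oodAtMost-extend (oodAtMost-refl w)

  near : ∀ {z} → OodAtMost D w z 2 → Near z
  near = oodAtMost-mono (s≤s (s≤s z≤n))

  w-near : Near w
  w-near = oodAtMost-mono z≤n (oodAtMost-refl w)

  record Candidates : Set where
    field
      vertex           : Fin t ⊎ Fin t → Fin n
      vertex-injective : Injective _≡_ _≡_ vertex
      fan              : ∀ p → Fan (vertex p)

  candidates-from : ∀ (f g : Fin t → Fin n) → Injective _≡_ _≡_ f → Injective _≡_ _≡_ g →
    (∀ i j → f i ≢ g j) → (∀ i → Fan (f i)) → (∀ j → Fan (g j)) → Candidates
  candidates-from f g f-inj g-inj f≢g f-fan g-fan = record
    { vertex = [ f , g ]′ ; vertex-injective = [,]-injective f-inj g-inj f≢g
    ; fan = λ { (inj₁ i) → f-fan i ; (inj₂ j) → g-fan j } }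

  -- x lies within distance 2 of w, so the out-neighbours of x have all their
  -- in-neighbours within distance 4.
  candidates-around : ∀ {x} → Edge D w x → Edge D x y₀ → Candidates
  candidates-around {x} w→x x→y₀ with inNeighbours x | outNeighbours x
  ... | g , g-inj , g→x | h , h-inj , x→h =
    candidates-from g h g-inj h-inj
      (λ i j gi≡hj → edge-asymmetric (g→x i) (subst (Edge D x) (sym gi≡hj) (x→h j)))
      (λ i → outFan δ (near (near₂ w→x (g→x i))))
      (λ j → inFan δ (oodAtMost-extend (near₂ w→y₀ x→y₀) (x→h j)))

  candidates-split : ∀ (g : Fin t → Fin n) → Injective _≡_ _≡_ g → (∀ i → Edge D (g i) y₀) →
    (∀ i → ¬ Edge D w (g i)) → Candidates
  candidates-split g g-inj g→y₀ w↛g with outNeighbours w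
  ... | h , h-inj , w→h =
    candidates-from g h g-inj h-inj
      (λ i j gi≡hj → w↛g i (subst (Edge D w) (sym gi≡hj) (w→h j)))
      (λ i → outFan δ (near (near₂ w→y₀ (g→y₀ i))))
      (λ j → inFan δ (near ∘ near₂ (w→h j)))

  candidates : Candidates
  candidates with inNeighbours y₀
  ... | g , g-inj , g→y₀ with any? (λ i → T? (E w (g i)))
  ...   | yes (i , w→g) = candidates-around w→g (g→y₀ i)
  ...   | no w↛g        = candidates-split g g-inj g→y₀ (λ i w→g → w↛g (i , w→g))
  open Candidates candidates

  enlarge : ∀ {k} → k < t → Matching k → Matching (suc k)
  enlarge k<t m with uncovered-pair m k<t vertex vertex-injective
  ... | p , q , p≢q , p∉ , q∉ =
    proj₁ (augment (p≢q ∘ vertex-injective) (fan p) (fan q) m p∉ q∉ k<t)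

  grow : ∀ k → k ≤ t → Matching k
  grow zero    _   = ∅
  grow (suc k) k<t = enlarge k<t (grow k (ℕ.<⇒≤ k<t))

  Rooted : ℕ → Set
  Rooted k = Σ (Matching (suc k)) λ m → endpoint m (zero , false) ≡ w

  to-front : ∀ {k} (m : Matching (suc k)) j → endpoint m (j , false) ≡ w → Rooted k
  to-front m j e = add (arc m j) (remove m j) (removed-uncovered m j) , e

  replace-by-w→y₀ : ∀ {k} (m : Matching (suc k)) j →
    ¬ Covers (remove m j) w → ¬ Covers (remove m j) y₀ → Rooted k
  replace-by-w→y₀ m j w∉ y₀∉ = add (arcOf w→y₀ w-near) (remove m j) fresh , refl
    where
    fresh : ∀ x → ¬ Covers (remove m j) (end (arcOf w→y₀ w-near) x)
    fresh false = w∉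
    fresh true  = y₀∉

  root-uncovered : ∀ {k} (m : Matching (suc k)) → ¬ Covers m w → Rooted k
  root-uncovered m w∉ with covers? m y₀
  ... | yes ((j , x) , e) = replace-by-w→y₀ m j (w∉ ∘ covers-remove⁻ m j)
                              (subst (¬_ ∘ Covers (remove m j)) e (removed-uncovered m j x))
  ... | no y₀∉            = replace-by-w→y₀ m zero (w∉ ∘ covers-remove⁻ m zero) (y₀∉ ∘ covers-remove⁻ m zero)

  uncovered-candidate-avoiding : ∀ {k} → k < t → (m : Matching k) → ∀ z →
    ∃ λ p → z ≢ vertex p × ¬ Covers m (vertex p)
  uncovered-candidate-avoiding k<t m z with uncovered-pair m k<t vertex vertex-injective
  ... | p , q , p≢q , p∉ , q∉ with z ≟ vertex p
  ...   | yes z≡p = q , (λ z≡q → p≢q (vertex-injective (trans (sym z≡p) z≡q))) , q∉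
  ...   | no  z≢p = p , z≢p , p∉

  -- With w a head, drop its edge and augment using the out-fan of w: afterwards
  -- w is either free or the tail of an edge.
  root-head : ∀ {k} → k < t → (m : Matching (suc k)) → ∀ j → endpoint m (j , true) ≡ w → Rooted k
  root-head k<t m j e with uncovered-candidate-avoiding k<t (remove m j) w
  ... | p , w≢p , p∉ with augment w≢p (outFan δ w-near) (fan p) (remove m j) w∉ p∉ k<t
    where
    w∉ = subst (¬_ ∘ Covers (remove m j)) e (removed-uncovered m j true)
  ...   | m′ , inj₁ w∉′        = root-uncovered m′ w∉′
  ...   | m′ , inj₂ (j′ , e′) = to-front m′ j′ e′

  root : ∀ {k} → k < t → Matching (suc k) → Rooted k
  root k<t m with covers? m w
  ... | no w∉                = root-uncovered m w∉
  ... | yes ((j , false) , e) = to-front m j e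
  ... | yes ((j , true)  , e) = root-head k<t m j e

  rooted-antimatching : ∀ {k K} → 4 ≤ K → Rooted k →
    ∃[ a ] ∃[ b ] (IsConnectedAntimatching D (suc k) a b
      × (∀ (i : Fin (suc k)) → toℕ i ≡ 0 → a i ≡ w)
      × (∀ (i j : Fin (suc k)) → toℕ j ≡ 0 → OodAtMost D (a j) (a i) K))
  rooted-antimatching {K = K} 4≤K (m , e) =
    tail , head , ((edge ∘ arc m , disjoint) , reachable) , rooted , close
    where
    tail head : Fin _ → Fin n
    tail i = endpoint m (i , false)
    head i = endpoint m (i , true)
    distinct : ∀ {i j x y} → i ≢ j → endpoint m (i , x) ≢ endpoint m (j , y)
    distinct i≢j = i≢j ∘ ,-injectiveˡ ∘ ends-injective m
    disjoint : ∀ i j → i ≢ j → (tail i ≢ tail j) × (tail i ≢ head j) × (head i ≢ head j)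
    disjoint i j i≢j = distinct i≢j , distinct i≢j , distinct i≢j
    rooted : ∀ i → toℕ i ≡ 0 → tail i ≡ w
    rooted zero _ = e
    close : ∀ i j → toℕ j ≡ 0 → OodAtMost D (tail j) (tail i) K
    close i j j₀ = subst (λ r → OodAtMost D r (tail i) K) (sym (rooted j j₀))
                         (oodAtMost-mono 4≤K (tail∈P (arc m i)))
    reachable : ∀ i j → toℕ j ≡ 0 → Out D (tail j) (tail i)
    reachable i j j₀ with close i j j₀
    ... | ℓ , _ , walk = ℓ , walk

lemma8 : ∀ (t : ℕ) {n : ℕ} (D : OrientedGraph n) → MinSemiDegreeAtLeast D t → (w : Fin n) →
    ∃[ a ] ∃[ b ] (IsConnectedAntimatching D t a b
      × (∀ (i : Fin t) → toℕ i ≡ 0 → a i ≡ w)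
      × (∀ (i j : Fin t) → toℕ j ≡ 0 → OodAtMost D (a j) (a i) (8 * t)))
lemma8 zero    D δ w = (λ ()) , (λ ()) , (((λ ()) , (λ ())) , (λ ())) , (λ ()) , (λ ())
lemma8 (suc t) D δ w =
  rooted-antimatching 4≤8[1+t] (root (ℕ.n<1+n t) (grow (suc t) ℕ.≤-refl))
  where
  open GraphProperties.Neighbours D δ using (outNeighbours)
  open Construction D δ (proj₂ (proj₂ (outNeighbours w)) zero)
  4≤8[1+t] : 4 ≤ 8 * suc t
  4≤8[1+t] = ℕ.≤-trans (ℕ.m≤m+n 4 4) (ℕ.m≤m*n 8 (suc t))
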